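{- For every integer $n \ge 0$, the number $\hat{d}_n$ of c-derangements of the facets of the $n$-dimensional hypercube $Q_n$ satisfies \[ \hat{d}_n = \sum_{k=0}^{n} \binom{n}{k} 2^k d_k, \] where $d_k$ denotes the number of derangements (fixed-point-free permutations) of a $k$-element set.
   Context: Let $Q_n$ be the regular $n$-dimensional hypercube, e.g. $[-1,1]^n \subset \mathbb{R}^n$; its $2n$ facets have centers $\pm e_1,\dots,\pm e_n$. Isometries of $Q_n$ correspond exactly to the $n\times n$ signed permutation matrices (permutation matrices whose nonzero entries are $\pm1$). A c-derangement is an isometry of $Q_n$ fixing no facet, i.e. a signed permutation matrix with no entry $+1$ on its main diagonal. By convention $d_0 = 1$ and $\hat{d}_0 = 1$. -}

module Defs where

open import Data.Nat using (ℕ; suc; _+_; _*_; _^_; _≤_)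
open import Data.Nat.Combinatorics using (_C_)
open import Data.Integer as ℤ using (ℤ; +_; -[1+_])
open import Data.Fin using (Fin)
open import Data.Vec using (Vec; lookup; count)
open import Data.List using (map; upTo)
open import Data.Nat.ListAction using (sum)
open import Data.Product using (_×_)
open import Data.Sum using (_⊎_)
open import Data.Refinement using (Refinement-syntax)
open import Relation.Binary.PropositionalEquality using (_≡_; _≢_)
open import Relation.Nullary using (¬?)
open import Function.Bundles using (_↔_)

-- n × n integer matrices, stored as a vector of rows (first-order data,
-- so propositional equality is entrywise equality).
Matrix : ℕ → Set
Matrix n = Vec (Vec ℤ n) n

entry : ∀ {n} → Matrix n → Fin n → Fin n → ℤ
entry M i j = lookup (lookup M i) j

rowNonzeros : ∀ {n} → Matrix n → Fin n → ℕ
rowNonzeros M i = count (λ x → ¬? (x ℤ.≟ + 0)) (lookup M i)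

colNonzeros : ∀ {n} → Matrix n → Fin n → ℕ
colNonzeros M j = count (λ x → ¬? (x ℤ.≟ + 0)) (Data.Vec.map (λ row → lookup row j) M)

IsSignedPermMatrix : ∀ {n} → Matrix n → Set
IsSignedPermMatrix {n} M =
  (∀ i j → (entry M i j ≡ + 0) ⊎ (entry M i j ≡ + 1) ⊎ (entry M i j ≡ -[1+ 0 ]))
  × (∀ i → rowNonzeros M i ≡ 1)
  × (∀ j → colNonzeros M j ≡ 1)

-- c-derangement of Q_n: a signed permutation matrix (isometry of Q_n)
-- with no entry +1 on the main diagonal (fixes no facet).
IsCDerangement : ∀ {n} → Matrix n → Set
IsCDerangement {n} M = IsSignedPermMatrix M × (∀ i → entry M i i ≢ + 1)

CDerangement : ℕ → Set
CDerangement n = [ M ∈ Matrix n ∣ IsCDerangement M ]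

IsDerangement : ∀ {k} → Vec (Fin k) k → Set
IsDerangement {k} v =
  (∀ i j → lookup v i ≡ lookup v j → i ≡ j) × (∀ i → lookup v i ≢ i)

Derangement : ℕ → Set
Derangement k = [ v ∈ Vec (Fin k) k ∣ IsDerangement v ]

HasCard : Set → ℕ → Set
HasCard A m = Fin m ↔ A

sumTo : ℕ → (ℕ → ℕ) → ℕ
sumTo n f = sum (map f (upTo (suc n)))

-- A signed permutation matrix is a permutation σ together with a sign for each row; it fixes
-- the facet e_i exactly when σ i = i with sign +1, so it is a c-derangement iff every fixed
-- point of σ carries the sign −1. Generalise to the set S(N, m) of such pairs on N points whose
-- fixed points all lie in {m, …, N − 1}. Splitting S(N + 1, m) according to whether m is fixed
-- gives S(N + 1, m) ≅ S(N, m) ⊎ S(N + 1, m + 1) (delete the fixed point m, whose sign is forced),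
-- and S(m, m) consists of a derangement with arbitrary signs, of size 2^m d_m. This is Pascal's
-- recurrence, so |S(n + m, m)| = Σ_k C(n, k) 2^(k + m) d_(k + m); take m = 0.

module Submission where

open import Defs
open import Data.Bool using (Bool; true; false)
import Data.Bool.Properties as Bool
open import Data.Fin using (Fin; zero; suc; toℕ; fromℕ<; punchIn; punchOut)
open import Data.Fin.Properties
  using ( _≟_; any?; 0≢1+n; suc-injective; toℕ<n; toℕ-injective; toℕ-fromℕ<; +↔⊎; *↔×; 2↔Bool
        ; punchInᵢ≢i; punchIn-injective; punchIn-punchOut; punchOut-punchIn; punchOut-injective
        ; injective⇒≤ )
open import Data.Fin.Permutation using (↔⇒≡)
import Data.Integer as ℤ
open import Data.Integer using (ℤ; 0ℤ; 1ℤ; -1ℤ)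
open import Data.List using (applyUpTo; _∷ʳ_)
open import Data.List.Properties using (map-upTo; applyUpTo-∷ʳ)
open import Data.Nat using (ℕ; zero; suc; _+_; _*_; _^_; _≤_; z≤n; s≤s)
open import Data.Nat.Combinatorics using (_C_; nCk+nC[k+1]≡[n+1]C[k+1]; k>n⇒nCk≡0)
open import Data.Nat.ListAction using (sum)
open import Data.Nat.ListAction.Properties using (sum-++)
import Data.Nat.Properties as ℕ
open import Data.Nat.Properties
  using ( +-commutativeSemigroup; +-assoc; *-assoc; +-comm; +-identityʳ; +-suc; *-distribʳ-+
        ; n<1+n; n≤1+n; 1+n≰n; <⇒≱; ≤-refl; ≤-trans; ≤∧≢⇒<; m≤n+m; m≤n⇒m≤1+n )
open import Algebra.Properties.CommutativeSemigroup +-commutativeSemigroup using (interchange)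
open import Data.Product using (_×_; _,_; proj₁; proj₂; ∃)
open import Data.Product.Function.NonDependent.Propositional using (_×-↔_)
open import Data.Sum using (_⊎_; inj₁; inj₂)
open import Data.Sum.Function.Propositional using (_⊎-↔_)
open import Data.Vec
  using (Vec; []; _∷_; count; lookup; map; tabulate; replicate; _[_]≔_; insertAt; removeAt; uncons)
import Data.Vec.Properties as Vec
open import Data.Vec.Properties
  using ( lookup-map; lookup∘tabulate; lookup∘update; lookup∘update′; lookup-replicate
        ; insertAt-lookup; insertAt-punchIn; removeAt-punchOut; insertAt-removeAt; removeAt-insertAt )
open import Data.Refinement using (Refinement-syntax; _,_; value-injective)
open import Data.Empty using (⊥-elim-irr)
open import Data.Irrelevant using ([_])
open import Function using (_∘_)
open import Function.Definitions using (Injective)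
open import Function.Bundles using (_↔_; mk↔ₛ′)
open import Function.Properties.Inverse using (↔-trans; ↔-sym)
open import Relation.Binary.PropositionalEquality
  using (_≡_; _≢_; refl; sym; trans; cong; cong₂; subst; module ≡-Reasoning)
open import Relation.Nullary using (¬_; ¬?; yes; no; contradiction)
open import Relation.Unary using (Decidable)
open import Relation.Nullary.Recomputable using (¬-recompute)
open import Relation.Nullary.Decidable using (recompute; decidable-stable)

-- Binomial sums

sumBelow : ℕ → (ℕ → ℕ) → ℕ
sumBelow N f = sum (applyUpTo f N)

sumTo≡sumBelow : ∀ n f → sumTo n f ≡ sumBelow (suc n) f
sumTo≡sumBelow n f = cong sum (map-upTo f (suc n))

sumBelow-cong : ∀ N {f g} → (∀ k → f k ≡ g k) → sumBelow N f ≡ sumBelow N g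
sumBelow-cong zero    f≗g = refl
sumBelow-cong (suc N) f≗g = cong₂ _+_ (f≗g 0) (sumBelow-cong N (f≗g ∘ suc))

sumBelow-+ : ∀ N f g → sumBelow N (λ k → f k + g k) ≡ sumBelow N f + sumBelow N g
sumBelow-+ zero    f g = refl
sumBelow-+ (suc N) f g = begin
  (f 0 + g 0) + sumBelow N (λ k → f (suc k) + g (suc k))
    ≡⟨ cong (f 0 + g 0 +_) (sumBelow-+ N (f ∘ suc) (g ∘ suc)) ⟩
  (f 0 + g 0) + (sumBelow N (f ∘ suc) + sumBelow N (g ∘ suc))
    ≡⟨ interchange (f 0) (g 0) _ _ ⟩
  (f 0 + sumBelow N (f ∘ suc)) + (g 0 + sumBelow N (g ∘ suc)) ∎
  where open ≡-Reasoning

sumBelow-suc : ∀ N f → sumBelow (suc N) f ≡ sumBelow N f + f N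
sumBelow-suc N f = begin
  sum (applyUpTo f (suc N))        ≡⟨ cong sum (applyUpTo-∷ʳ f N) ⟨
  sum (applyUpTo f N ∷ʳ f N)       ≡⟨ sum-++ (applyUpTo f N) _ ⟩
  sumBelow N f + (f N + 0)         ≡⟨ cong (sumBelow N f +_) (+-identityʳ (f N)) ⟩
  sumBelow N f + f N               ∎
  where open ≡-Reasoning

binomialSum : ℕ → (ℕ → ℕ) → ℕ
binomialSum n f = sumBelow (suc n) (λ k → (n C k) * f k)

binomialSum-cong : ∀ n {f g} → (∀ k → f k ≡ g k) → binomialSum n f ≡ binomialSum n g
binomialSum-cong n f≗g = sumBelow-cong (suc n) (λ k → cong ((n C k) *_) (f≗g k))

binomialSum-suc : ∀ n f → binomialSum (suc n) f ≡ binomialSum n f + binomialSum n (f ∘ suc)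
binomialSum-suc n f = begin
  f0 + sumBelow (suc n) (λ k → (suc n C suc k) * f (suc k))
    ≡⟨ cong (f0 +_) (sumBelow-cong (suc n) pascal) ⟩
  f0 + sumBelow (suc n) (λ k → (n C k) * f (suc k) + (n C suc k) * f (suc k))
    ≡⟨ cong (f0 +_) (sumBelow-+ (suc n) (λ k → (n C k) * f (suc k)) shifted) ⟩
  f0 + (binomialSum n (f ∘ suc) + sumBelow (suc n) shifted)
    ≡⟨ cong (λ x → f0 + (binomialSum n (f ∘ suc) + x)) (sumBelow-suc n shifted) ⟩
  f0 + (binomialSum n (f ∘ suc) + (sumBelow n shifted + (n C suc n) * f (suc n)))
    ≡⟨ cong (λ x → f0 + (binomialSum n (f ∘ suc) + (sumBelow n shifted + x * f (suc n))))
            (k>n⇒nCk≡0 (n<1+n n)) ⟩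
  f0 + (binomialSum n (f ∘ suc) + (sumBelow n shifted + 0))
    ≡⟨ cong (λ x → f0 + (binomialSum n (f ∘ suc) + x)) (+-identityʳ _) ⟩
  f0 + (binomialSum n (f ∘ suc) + sumBelow n shifted)
    ≡⟨ cong (f0 +_) (+-comm (binomialSum n (f ∘ suc)) _) ⟩
  f0 + (sumBelow n shifted + binomialSum n (f ∘ suc))
    ≡⟨ +-assoc f0 _ _ ⟨
  binomialSum n f + binomialSum n (f ∘ suc) ∎
  where
  open ≡-Reasoning
  -- the k = 0 term of both sides, as n C 0 and suc n C 0 reduce to 1
  f0 : ℕ
  f0 = 1 * f 0
  shifted : ℕ → ℕ
  shifted k = (n C suc k) * f (suc k)
  pascal : ∀ k → (suc n C suc k) * f (suc k) ≡ (n C k) * f (suc k) + (n C suc k) * f (suc k)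
  pascal k = trans (cong (_* f (suc k)) (sym (nCk+nC[k+1]≡[n+1]C[k+1] n k)))
                   (*-distribʳ-+ (f (suc k)) (n C k) (n C suc k))

-- Finite cardinalities

hasCard-unique : ∀ {A a b} → HasCard A a → HasCard A b → a ≡ b
hasCard-unique A≅a A≅b = ↔⇒≡ (↔-trans A≅a (↔-sym A≅b))

hasCard-⊎ : ∀ {A B a b} → HasCard A a → HasCard B b → HasCard (A ⊎ B) (a + b)
hasCard-⊎ A≅a B≅b = ↔-trans +↔⊎ (A≅a ⊎-↔ B≅b)

hasCard-× : ∀ {A B a b} → HasCard A a → HasCard B b → HasCard (A × B) (a * b)
hasCard-× A≅a B≅b = ↔-trans *↔× (A≅a ×-↔ B≅b)

hasCard-Vec-Bool : ∀ m → HasCard (Vec Bool m) (2 ^ m)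
hasCard-Vec-Bool zero    = mk↔ₛ′ (λ _ → []) (λ _ → zero) (λ { [] → refl }) (λ { zero → refl })
hasCard-Vec-Bool (suc m) = ↔-trans (hasCard-× 2↔Bool (hasCard-Vec-Bool m)) ×↔∷
  where
  ×↔∷ : (Bool × Vec Bool m) ↔ Vec Bool (suc m)
  ×↔∷ = mk↔ₛ′ (λ (b , bs) → b ∷ bs) uncons (λ { (b ∷ bs) → refl }) (λ _ → refl)

injective⇒surjective : ∀ {n} {f : Fin n → Fin n} →
                       Injective _≡_ _≡_ f → ∀ j → ∃ λ i → f i ≡ j
injective⇒surjective {suc n} {f} f-inj j with any? (λ i → f i ≟ j)
... | yes hit  = hit
... | no  miss = contradiction (injective⇒≤ squeezed-inj) 1+n≰n
  where
  j≢f : ∀ i → j ≢ f i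
  j≢f i j≡fi = miss (i , sym j≡fi)
  squeezed-inj : Injective _≡_ _≡_ (λ i → punchOut (j≢f i))
  squeezed-inj eq = f-inj (punchOut-injective (j≢f _) (j≢f _) eq)

-- Inserting and removing a fixed point

data PunchView {n} (p : Fin (suc n)) : Fin (suc n) → Set where
  pivot   : PunchView p p
  punched : ∀ i → PunchView p (punchIn p i)

punchView : ∀ {n} (p j : Fin (suc n)) → PunchView p j
punchView p j with p ≟ j
... | yes refl = pivot
... | no  p≢j  = subst (PunchView p) (punchIn-punchOut p≢j) (punched (punchOut p≢j))

≤-punchIn : ∀ {n} (p : Fin (suc n)) i → toℕ i ≤ toℕ (punchIn p i)
≤-punchIn zero    i       = n≤1+n (toℕ i)
≤-punchIn (suc p) zero    = z≤n
≤-punchIn (suc p) (suc i) = s≤s (≤-punchIn p i)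

pivot≤punchIn⇒pivot≤ : ∀ {n} (p : Fin (suc n)) i → toℕ p ≤ toℕ (punchIn p i) → toℕ p ≤ toℕ i
pivot≤punchIn⇒pivot≤ zero    i       _         = z≤n
pivot≤punchIn⇒pivot≤ (suc p) (suc i) (s≤s p≤) = s≤s (pivot≤punchIn⇒pivot≤ p i p≤)

lookup-ext : ∀ {A : Set} {n} {xs ys : Vec A n} → (∀ i → lookup xs i ≡ lookup ys i) → xs ≡ ys
lookup-ext {xs = []}     {[]}     _  = refl
lookup-ext {xs = x ∷ xs} {y ∷ ys} eq = cong₂ _∷_ (eq zero) (lookup-ext (eq ∘ suc))

lookup-removeAt-punchIn : ∀ {A : Set} {n} (xs : Vec A (suc n)) p i →
                          lookup (removeAt xs p) i ≡ lookup xs (punchIn p i)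
lookup-removeAt-punchIn xs p i =
  trans (cong (lookup (removeAt xs p)) (sym (punchOut-punchIn p))) (removeAt-punchOut xs _)

IsInjective : ∀ {A : Set} {n} → Vec A n → Set
IsInjective xs = ∀ i j → lookup xs i ≡ lookup xs j → i ≡ j

map-injective : ∀ {A B : Set} {n} {f : A → B} {xs : Vec A n} →
                (∀ x y → f x ≡ f y → x ≡ y) → IsInjective xs → IsInjective (map f xs)
map-injective {f = f} {xs} f-inj xs-inj i j eq =
  xs-inj i j (f-inj _ _ (trans (sym (lookup-map i f xs)) (trans eq (lookup-map j f xs))))

insertAt-injective : ∀ {A : Set} {n} {xs : Vec A n} {v} p →
                     IsInjective xs → (∀ i → lookup xs i ≢ v) → IsInjective (insertAt xs p v)
insertAt-injective {xs = xs} {v} p xs-inj v∉xs i j eq with punchView p i | punchView p j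
... | pivot     | pivot     = refl
... | pivot     | punched l =
  contradiction (trans (sym (insertAt-punchIn xs p v l)) (trans (sym eq) (insertAt-lookup xs p v))) (v∉xs l)
... | punched k | pivot     =
  contradiction (trans (sym (insertAt-punchIn xs p v k)) (trans eq (insertAt-lookup xs p v))) (v∉xs k)
... | punched k | punched l =
  cong (punchIn p) (xs-inj k l
    (trans (sym (insertAt-punchIn xs p v k)) (trans eq (insertAt-punchIn xs p v l))))

module _ {n} (p : Fin (suc n)) where

  insertFixedPoint : Vec (Fin n) n → Vec (Fin (suc n)) (suc n)
  insertFixedPoint τ = insertAt (map (punchIn p) τ) p p

  lookup-insertFixedPoint-pivot : ∀ τ → lookup (insertFixedPoint τ) p ≡ p
  lookup-insertFixedPoint-pivot τ = insertAt-lookup _ p p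

  lookup-insertFixedPoint-punchIn : ∀ τ i →
    lookup (insertFixedPoint τ) (punchIn p i) ≡ punchIn p (lookup τ i)
  lookup-insertFixedPoint-punchIn τ i = trans (insertAt-punchIn _ p p i) (lookup-map i (punchIn p) τ)

  insertFixedPoint-injective : ∀ τ → IsInjective τ → IsInjective (insertFixedPoint τ)
  insertFixedPoint-injective τ τ-inj =
    insertAt-injective p (map-injective {xs = τ} (punchIn-injective p) τ-inj)
      λ i eq → punchInᵢ≢i p (lookup τ i) (trans (sym (lookup-map i (punchIn p) τ)) eq)

  fixedPoint-avoided : ∀ σ → IsInjective σ → lookup σ p ≡ p → ∀ i → p ≢ lookup σ (punchIn p i)
  fixedPoint-avoided σ σ-inj σp≡p i p≡σi = punchInᵢ≢i p i (σ-inj _ _ (trans (sym p≡σi) (sym σp≡p)))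

  removeFixedPoint : (σ : Vec (Fin (suc n)) (suc n)) → .(∀ i → p ≢ lookup σ (punchIn p i)) →
                     Vec (Fin n) n
  removeFixedPoint σ avoids = tabulate (λ i → punchOut (¬-recompute (avoids i)))

  punchIn-removeFixedPoint : ∀ σ .avoids i →
    punchIn p (lookup (removeFixedPoint σ avoids) i) ≡ lookup σ (punchIn p i)
  punchIn-removeFixedPoint σ avoids i =
    trans (cong (punchIn p) (lookup∘tabulate _ i)) (punchIn-punchOut _)

  removeFixedPoint-injective : ∀ σ .avoids → IsInjective σ → IsInjective (removeFixedPoint σ avoids)
  removeFixedPoint-injective σ avoids σ-inj i j eq = punchIn-injective p i j (σ-inj _ _
    (trans (sym (punchIn-removeFixedPoint σ avoids i))
      (trans (cong (punchIn p) eq) (punchIn-removeFixedPoint σ avoids j))))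

  removeFixedPoint-insertFixedPoint : ∀ τ .avoids → removeFixedPoint (insertFixedPoint τ) avoids ≡ τ
  removeFixedPoint-insertFixedPoint τ avoids = lookup-ext λ i → punchIn-injective p _ _
    (trans (punchIn-removeFixedPoint (insertFixedPoint τ) avoids i) (lookup-insertFixedPoint-punchIn τ i))

  insertFixedPoint-removeFixedPoint : ∀ σ .avoids → lookup σ p ≡ p →
                                      insertFixedPoint (removeFixedPoint σ avoids) ≡ σ
  insertFixedPoint-removeFixedPoint σ avoids σp≡p = begin
    insertAt (map (punchIn p) (removeFixedPoint σ avoids)) p p
      ≡⟨ cong (λ xs → insertAt xs p p) (lookup-ext punchIn∘removed) ⟩
    insertAt (removeAt σ p) p p
      ≡⟨ cong (insertAt (removeAt σ p) p) σp≡p ⟨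
    insertAt (removeAt σ p) p (lookup σ p)
      ≡⟨ insertAt-removeAt σ p ⟩
    σ ∎
    where
    open ≡-Reasoning
    punchIn∘removed : ∀ i → lookup (map (punchIn p) (removeFixedPoint σ avoids)) i ≡
                            lookup (removeAt σ p) i
    punchIn∘removed i = trans (lookup-map i (punchIn p) (removeFixedPoint σ avoids))
      (trans (punchIn-removeFixedPoint σ avoids i) (sym (lookup-removeAt-punchIn σ p i)))

-- Signed permutations

-- (σ , s) stands for the matrix whose only nonzero entry in row i is at column σ i and
-- equals −1 if s i is true, +1 otherwise.
SignedMap : ℕ → Set
SignedMap n = Vec (Fin n) n × Vec Bool n

-- For m = 0 this says that (σ , s) is a c-derangement; larger m also forbids the first m
-- diagonal entries to be nonzero.
record IsCDerangementFrom {n} (m : ℕ) (σ : Vec (Fin n) n) (s : Vec Bool n) : Set where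
  constructor isCDerangementFrom
  field
    injective     : IsInjective σ
    fixed⇒m≤    : ∀ i → lookup σ i ≡ i → m ≤ toℕ i
    fixed⇒negative : ∀ i → lookup σ i ≡ i → lookup s i ≡ true

open IsCDerangementFrom

CDerangementFrom : ℕ → ℕ → Set
CDerangementFrom n m = [ σs ∈ SignedMap n ∣ IsCDerangementFrom m (proj₁ σs) (proj₂ σs) ]

CDerangementFrom[n,n]↔Vec×Derangement : ∀ n → CDerangementFrom n n ↔ (Vec Bool n × Derangement n)
CDerangementFrom[n,n]↔Vec×Derangement n = mk↔ₛ′ to from (λ _ → refl) (λ _ → refl)
  where
  to : CDerangementFrom n n → Vec Bool n × Derangement n
  to ((σ , s) , [ ok ]) =
    s , (σ , [ injective ok , (λ i σi≡i → <⇒≱ (toℕ<n i) (fixed⇒m≤ ok i σi≡i)) ])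
  from : Vec Bool n × Derangement n → CDerangementFrom n n
  from (s , (σ , [ σ-ok ])) = (σ , s) , [ isCDerangementFrom (proj₁ σ-ok)
    (λ i σi≡i → contradiction σi≡i (proj₂ σ-ok i)) (λ i σi≡i → contradiction σi≡i (proj₂ σ-ok i)) ]

isCDerangementFrom-mono : ∀ {n m m′} {σ : Vec (Fin n) n} {s} → m ≤ m′ →
                          IsCDerangementFrom m′ σ s → IsCDerangementFrom m σ s
isCDerangementFrom-mono m≤m′ ok =
  isCDerangementFrom (injective ok) (λ i σi≡i → ≤-trans m≤m′ (fixed⇒m≤ ok i σi≡i)) (fixed⇒negative ok)

module _ {n} (p : Fin (suc n)) where

  isCDerangementFrom-removeFixedPoint : ∀ {σ s} .avoids →
    IsCDerangementFrom (toℕ p) σ s → lookup σ p ≡ p →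
    IsCDerangementFrom (toℕ p) (removeFixedPoint p σ avoids) (removeAt s p)
  isCDerangementFrom-removeFixedPoint {σ} {s} avoids ok σp≡p = isCDerangementFrom
    (removeFixedPoint-injective p σ avoids (injective ok))
    (λ i eq → pivot≤punchIn⇒pivot≤ p i (fixed⇒m≤ ok (punchIn p i) (lifted i eq)))
    (λ i eq → trans (lookup-removeAt-punchIn s p i) (fixed⇒negative ok (punchIn p i) (lifted i eq)))
    where
    lifted : ∀ i → lookup (removeFixedPoint p σ avoids) i ≡ i → lookup σ (punchIn p i) ≡ punchIn p i
    lifted i eq = trans (sym (punchIn-removeFixedPoint p σ avoids i)) (cong (punchIn p) eq)

  isCDerangementFrom-insertFixedPoint : ∀ {τ s} → IsCDerangementFrom (toℕ p) τ s →
    IsCDerangementFrom (toℕ p) (insertFixedPoint p τ) (insertAt s p true)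
  isCDerangementFrom-insertFixedPoint {τ} {s} ok =
    isCDerangementFrom (insertFixedPoint-injective p τ (injective ok)) late negated
    where
    lowered : ∀ i → lookup (insertFixedPoint p τ) (punchIn p i) ≡ punchIn p i → lookup τ i ≡ i
    lowered i eq = punchIn-injective p _ _ (trans (sym (lookup-insertFixedPoint-punchIn p τ i)) eq)
    late : ∀ j → lookup (insertFixedPoint p τ) j ≡ j → toℕ p ≤ toℕ j
    late j eq with punchView p j
    ... | pivot     = ≤-refl
    ... | punched i = ≤-trans (fixed⇒m≤ ok i (lowered i eq)) (≤-punchIn p i)
    negated : ∀ j → lookup (insertFixedPoint p τ) j ≡ j → lookup (insertAt s p true) j ≡ true
    negated j eq with punchView p j
    ... | pivot     = insertAt-lookup s p true
    ... | punched i = trans (insertAt-punchIn s p true i) (fixed⇒negative ok i (lowered i eq))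

  isCDerangementFrom-suc : ∀ {σ s} → IsCDerangementFrom (toℕ p) σ s → lookup σ p ≢ p →
                           IsCDerangementFrom (suc (toℕ p)) σ s
  isCDerangementFrom-suc {σ} ok σp≢p = isCDerangementFrom (injective ok)
    (λ i σi≡i → ≤∧≢⇒< (fixed⇒m≤ ok i σi≡i)
      (λ p≡i → σp≢p (subst (λ j → lookup σ j ≡ j) (sym (toℕ-injective p≡i)) σi≡i)))
    (fixed⇒negative ok)

  CDerangementFrom-splitAt : CDerangementFrom (suc n) (toℕ p) ↔
                             (CDerangementFrom n (toℕ p) ⊎ CDerangementFrom (suc n) (suc (toℕ p)))
  CDerangementFrom-splitAt = mk↔ₛ′ to from to∘from from∘to
    where
    to : CDerangementFrom (suc n) (toℕ p) →
         CDerangementFrom n (toℕ p) ⊎ CDerangementFrom (suc n) (suc (toℕ p))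
    to ((σ , s) , [ ok ]) with lookup σ p ≟ p
    ... | yes σp≡p =
      inj₁ ((removeFixedPoint p σ (fixedPoint-avoided p σ (injective ok) σp≡p) , removeAt s p)
           , [ isCDerangementFrom-removeFixedPoint (fixedPoint-avoided p σ (injective ok) σp≡p) ok σp≡p ])
    ... | no  σp≢p = inj₂ ((σ , s) , [ isCDerangementFrom-suc ok σp≢p ])

    from : CDerangementFrom n (toℕ p) ⊎ CDerangementFrom (suc n) (suc (toℕ p)) →
           CDerangementFrom (suc n) (toℕ p)
    from (inj₁ ((τ , s) , [ ok ])) =
      (insertFixedPoint p τ , insertAt s p true) , [ isCDerangementFrom-insertFixedPoint ok ]
    from (inj₂ (σs , [ ok ]))      = σs , [ isCDerangementFrom-mono (n≤1+n (toℕ p)) ok ]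

    to∘from : ∀ y → to (from y) ≡ y
    to∘from (inj₁ ((τ , s) , [ ok ])) with lookup (insertFixedPoint p τ) p ≟ p
    ... | yes σp≡p = cong inj₁ (value-injective (cong₂ _,_
            (removeFixedPoint-insertFixedPoint p τ
              (fixedPoint-avoided p (insertFixedPoint p τ) (insertFixedPoint-injective p τ (injective ok)) σp≡p))
            (removeAt-insertAt s p true)))
    ... | no  σp≢p = contradiction (lookup-insertFixedPoint-pivot p τ) σp≢p
    to∘from (inj₂ ((σ , s) , [ ok ])) with lookup σ p ≟ p
    ... | yes σp≡p = ⊥-elim-irr (1+n≰n (fixed⇒m≤ ok p σp≡p))
    ... | no  _    = refl

    from∘to : ∀ x → from (to x) ≡ x
    from∘to ((σ , s) , [ ok ]) with lookup σ p ≟ p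
    ... | yes σp≡p = value-injective (cong₂ _,_
            (insertFixedPoint-removeFixedPoint p σ (fixedPoint-avoided p σ (injective ok) σp≡p) σp≡p)
            (trans (cong (insertAt (removeAt s p) p) (sym sp≡true)) (insertAt-removeAt s p)))
      where
      -- ok is irrelevant, so the equation it provides is recomputed by deciding it
      sp≡true : lookup s p ≡ true
      sp≡true = recompute (lookup s p Bool.≟ true) (fixed⇒negative ok p σp≡p)
    ... | no  _    = refl

CDerangementFrom-split : ∀ {n m} → m ≤ n →
  CDerangementFrom (suc n) m ↔ (CDerangementFrom n m ⊎ CDerangementFrom (suc n) (suc m))
CDerangementFrom-split {n} m≤n =
  subst (λ m → CDerangementFrom (suc n) m ↔ (CDerangementFrom n m ⊎ CDerangementFrom (suc n) (suc m)))
        (toℕ-fromℕ< (s≤s m≤n)) (CDerangementFrom-splitAt (fromℕ< (s≤s m≤n)))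

-- Signed permutation matrices

module _ {A : Set} {P : A → Set} (P? : Decidable P) where

  UniqueAt : ∀ {n} → Vec A n → Fin n → Set
  UniqueAt xs j = P (lookup xs j) × (∀ k → P (lookup xs k) → k ≡ j)

  count≡0⇒none : ∀ {n} (xs : Vec A n) → count P? xs ≡ 0 → ∀ i → ¬ P (lookup xs i)
  count≡0⇒none (x ∷ xs) none i with P? x | i
  ... | no ¬px | zero  = ¬px
  ... | no _   | suc i = count≡0⇒none xs none i

  none⇒count≡0 : ∀ {n} (xs : Vec A n) → (∀ i → ¬ P (lookup xs i)) → count P? xs ≡ 0
  none⇒count≡0 []       _    = refl
  none⇒count≡0 (x ∷ xs) none with P? x
  ... | yes px = contradiction px (none zero)
  ... | no  _  = none⇒count≡0 xs (none ∘ suc)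

  count≡1⇒uniqueAt : ∀ {n} (xs : Vec A n) → count P? xs ≡ 1 → ∃ (UniqueAt xs)
  count≡1⇒uniqueAt (x ∷ xs) one with P? x
  ... | yes px = zero , px , λ where
        zero    _  → refl
        (suc k) pk → contradiction pk (count≡0⇒none xs (ℕ.suc-injective one) k)
  ... | no ¬px with count≡1⇒uniqueAt xs one
  ...   | j , pj , unique = suc j , pj , λ where
          zero    p0 → contradiction p0 ¬px
          (suc k) pk → cong suc (unique k pk)

  uniqueAt⇒count≡1 : ∀ {n} (xs : Vec A n) j → UniqueAt xs j → count P? xs ≡ 1
  uniqueAt⇒count≡1 (x ∷ xs) zero (pj , unique) with P? x
  ... | yes _  = cong suc (none⇒count≡0 xs (λ k pk → 0≢1+n (sym (unique (suc k) pk))))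
  ... | no ¬px = contradiction pj ¬px
  uniqueAt⇒count≡1 (x ∷ xs) (suc j) (pj , unique) with P? x
  ... | yes px = contradiction (unique zero px) 0≢1+n
  ... | no  _  = uniqueAt⇒count≡1 xs j (pj , λ k pk → suc-injective (unique (suc k) pk))

nonzero? : Decidable (_≢ 0ℤ)
nonzero? x = ¬? (x ℤ.≟ 0ℤ)

column : ∀ {n} → Matrix n → Fin n → Vec ℤ n
column M j = map (λ row → lookup row j) M

lookup-column : ∀ {n} (M : Matrix n) i j → lookup (column M j) i ≡ entry M i j
lookup-column M i j = lookup-map i (λ row → lookup row j) M

signOf : Bool → ℤ
signOf true  = -1ℤ
signOf false = 1ℤ

isNegative : ℤ → Bool
isNegative (ℤ.+ _)    = false
isNegative ℤ.-[1+ _ ] = true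

signOf-nonzero : ∀ b → signOf b ≢ 0ℤ
signOf-nonzero true  ()
signOf-nonzero false ()

isNegative-signOf : ∀ b → isNegative (signOf b) ≡ b
isNegative-signOf true  = refl
isNegative-signOf false = refl

toMatrix : ∀ {n} → SignedMap n → Matrix n
toMatrix {n} (σ , s) = tabulate (λ i → replicate n 0ℤ [ lookup σ i ]≔ signOf (lookup s i))

module _ {n} (σ : Vec (Fin n) n) (s : Vec Bool n) where

  entry-toMatrix-image : ∀ i → entry (toMatrix (σ , s)) i (lookup σ i) ≡ signOf (lookup s i)
  entry-toMatrix-image i = trans (cong (λ row → lookup row (lookup σ i)) (lookup∘tabulate _ i))
                                 (lookup∘update (lookup σ i) (replicate n 0ℤ) _)

  entry-toMatrix-other : ∀ i j → lookup σ i ≢ j → entry (toMatrix (σ , s)) i j ≡ 0ℤ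
  entry-toMatrix-other i j σi≢j = trans (cong (λ row → lookup row j) (lookup∘tabulate _ i))
    (trans (lookup∘update′ (σi≢j ∘ sym) (replicate n 0ℤ) _) (lookup-replicate j 0ℤ))

  toMatrix-nonzero⇒image : ∀ i j → entry (toMatrix (σ , s)) i j ≢ 0ℤ → lookup σ i ≡ j
  toMatrix-nonzero⇒image i j nz with lookup σ i ≟ j
  ... | yes σi≡j = σi≡j
  ... | no  σi≢j = contradiction (entry-toMatrix-other i j σi≢j) nz

  toMatrix-row-uniqueAt : ∀ i → UniqueAt nonzero? (lookup (toMatrix (σ , s)) i) (lookup σ i)
  toMatrix-row-uniqueAt i =
    (λ e → signOf-nonzero (lookup s i) (trans (sym (entry-toMatrix-image i)) e)) ,
    (λ k nz → sym (toMatrix-nonzero⇒image i k nz))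

  toMatrix-column-uniqueAt : IsInjective σ → ∀ i →
                             UniqueAt nonzero? (column (toMatrix (σ , s)) (lookup σ i)) i
  toMatrix-column-uniqueAt σ-inj i =
    (λ e → signOf-nonzero (lookup s i) (trans (sym (entry-toMatrix-image i)) (trans (sym (lookup-col i)) e))) ,
    (λ k nz → σ-inj k i (toMatrix-nonzero⇒image k (lookup σ i) (nz ∘ trans (lookup-col k))))
    where
    lookup-col : ∀ k → lookup (column (toMatrix (σ , s)) (lookup σ i)) k ≡ entry (toMatrix (σ , s)) k (lookup σ i)
    lookup-col k = lookup-column (toMatrix (σ , s)) k (lookup σ i)

  toMatrix-isCDerangement : IsCDerangementFrom 0 σ s → IsCDerangement (toMatrix (σ , s))
  toMatrix-isCDerangement ok = (values , rows , columns) , diagonal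
    where
    values : ∀ i j → let x = entry (toMatrix (σ , s)) i j in x ≡ 0ℤ ⊎ x ≡ 1ℤ ⊎ x ≡ -1ℤ
    values i j with lookup σ i ≟ j
    ... | no  σi≢j = inj₁ (entry-toMatrix-other i j σi≢j)
    ... | yes refl with lookup s i | entry-toMatrix-image i
    ...   | false | e = inj₂ (inj₁ e)
    ...   | true  | e = inj₂ (inj₂ e)
    rows : ∀ i → rowNonzeros (toMatrix (σ , s)) i ≡ 1
    rows i = uniqueAt⇒count≡1 nonzero? (lookup (toMatrix (σ , s)) i) (lookup σ i)
                              (toMatrix-row-uniqueAt i)
    columns : ∀ j → colNonzeros (toMatrix (σ , s)) j ≡ 1
    columns j with injective⇒surjective (λ {i} {i′} → injective ok i i′) j
    ... | i , refl = uniqueAt⇒count≡1 nonzero? (column (toMatrix (σ , s)) (lookup σ i)) i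
                                      (toMatrix-column-uniqueAt (injective ok) i)
    diagonal : ∀ i → entry (toMatrix (σ , s)) i i ≢ 1ℤ
    diagonal i e = contradiction (begin
      -1ℤ                                      ≡⟨ cong signOf (fixed⇒negative ok i σi≡i) ⟨
      signOf (lookup s i)                      ≡⟨ entry-toMatrix-image i ⟨
      entry (toMatrix (σ , s)) i (lookup σ i)  ≡⟨ cong (entry (toMatrix (σ , s)) i) σi≡i ⟩
      entry (toMatrix (σ , s)) i i             ≡⟨ e ⟩
      1ℤ                                       ∎) λ ()
      where
      open ≡-Reasoning
      σi≡i : lookup σ i ≡ i
      σi≡i = toMatrix-nonzero⇒image i i (λ e₀ → contradiction (trans (sym e) e₀) λ ())

uniqueAt-ext : ∀ {n} {r r′ : Vec ℤ n} {j} → UniqueAt nonzero? r j → UniqueAt nonzero? r′ j →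
               lookup r j ≡ lookup r′ j → r ≡ r′
uniqueAt-ext {r = r} {r′} {j} (_ , unique) (_ , unique′) rj≡r′j = lookup-ext entry≡
  where
  vanishesOff : ∀ xs → (∀ k → lookup xs k ≢ 0ℤ → k ≡ j) → ∀ k → k ≢ j → lookup xs k ≡ 0ℤ
  vanishesOff xs unique k k≢j = decidable-stable (lookup xs k ℤ.≟ 0ℤ) (k≢j ∘ unique k)
  entry≡ : ∀ k → lookup r k ≡ lookup r′ k
  entry≡ k with k ≟ j
  ... | yes refl = rj≡r′j
  ... | no  k≢j  = trans (vanishesOff r unique k k≢j) (sym (vanishesOff r′ unique′ k k≢j))

signOf-isNegative : ∀ {x} → x ≡ 0ℤ ⊎ x ≡ 1ℤ ⊎ x ≡ -1ℤ → x ≢ 0ℤ → signOf (isNegative x) ≡ x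
signOf-isNegative (inj₁ x≡0)        x≢0 = contradiction x≡0 x≢0
signOf-isNegative (inj₂ (inj₁ refl)) _  = refl
signOf-isNegative (inj₂ (inj₂ refl)) _  = refl

-- Since the membership proof of a c-derangement is irrelevant, the permutation has to be
-- found by searching the row.
nonzeroColumn : ∀ {n} → Matrix n → Fin n → Fin n
nonzeroColumn M i with any? (λ j → nonzero? (entry M i j))
... | yes (j , _) = j
... | no  _       = i

nonzeroColumn-uniqueAt : ∀ {n} (M : Matrix n) i {j} →
                         UniqueAt nonzero? (lookup M i) j → nonzeroColumn M i ≡ j
nonzeroColumn-uniqueAt M i {j} (nz , unique) with any? (λ j → nonzero? (entry M i j))
... | yes (k , nzk) = unique k nzk
... | no  none      = contradiction (j , nz) none

fromMatrix : ∀ {n} → Matrix n → SignedMap n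
fromMatrix M =
  tabulate (nonzeroColumn M) , tabulate (λ i → isNegative (entry M i (nonzeroColumn M i)))

fromMatrix-toMatrix : ∀ {n} (σs : SignedMap n) → fromMatrix (toMatrix σs) ≡ σs
fromMatrix-toMatrix (σ , s) = cong₂ _,_
  (lookup-ext λ i → trans (lookup∘tabulate _ i) (nonzeroColumn≡image i))
  (lookup-ext λ i → begin
    lookup (tabulate (λ i → isNegative (entry M i (nonzeroColumn M i)))) i
      ≡⟨ lookup∘tabulate _ i ⟩
    isNegative (entry M i (nonzeroColumn M i))
      ≡⟨ cong (isNegative ∘ entry M i) (nonzeroColumn≡image i) ⟩
    isNegative (entry M i (lookup σ i))
      ≡⟨ cong isNegative (entry-toMatrix-image σ s i) ⟩
    isNegative (signOf (lookup s i))
      ≡⟨ isNegative-signOf (lookup s i) ⟩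
    lookup s i ∎)
  where
  open ≡-Reasoning
  M = toMatrix (σ , s)
  nonzeroColumn≡image : ∀ i → nonzeroColumn M i ≡ lookup σ i
  nonzeroColumn≡image i = nonzeroColumn-uniqueAt M i (toMatrix-row-uniqueAt σ s i)

isNegative-unit : ∀ {x} → x ≡ 0ℤ ⊎ x ≡ 1ℤ ⊎ x ≡ -1ℤ → x ≢ 0ℤ → x ≢ 1ℤ → isNegative x ≡ true
isNegative-unit (inj₁ x≡0)         x≢0 _   = contradiction x≡0 x≢0
isNegative-unit (inj₂ (inj₁ x≡1))  _   x≢1 = contradiction x≡1 x≢1
isNegative-unit (inj₂ (inj₂ refl)) _   _   = refl

module _ {n} {M : Matrix n} (M-ok : IsCDerangement M) where

  private
    values   = proj₁ (proj₁ M-ok)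
    rows     = proj₁ (proj₂ (proj₁ M-ok))
    columns  = proj₂ (proj₂ (proj₁ M-ok))
    diagonal = proj₂ M-ok

    lookup-nonzeroColumns : ∀ i → lookup (proj₁ (fromMatrix M)) i ≡ nonzeroColumn M i
    lookup-nonzeroColumns i = lookup∘tabulate (nonzeroColumn M) i

  row-uniqueAt-nonzeroColumn : ∀ i → UniqueAt nonzero? (lookup M i) (nonzeroColumn M i)
  row-uniqueAt-nonzeroColumn i with count≡1⇒uniqueAt nonzero? (lookup M i) (rows i)
  ... | j , unique-j =
    subst (UniqueAt nonzero? (lookup M i)) (sym (nonzeroColumn-uniqueAt M i unique-j)) unique-j

  column-unique : ∀ j i i′ → entry M i j ≢ 0ℤ → entry M i′ j ≢ 0ℤ → i ≡ i′
  column-unique j i i′ nz nz′ with count≡1⇒uniqueAt nonzero? (column M j) (columns j)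
  ... | _ , _ , unique = trans (unique i (nz ∘ trans (sym (lookup-column M i j))))
                               (sym (unique i′ (nz′ ∘ trans (sym (lookup-column M i′ j)))))

  fromMatrix-isCDerangementFrom : IsCDerangementFrom 0 (proj₁ (fromMatrix M)) (proj₂ (fromMatrix M))
  fromMatrix-isCDerangementFrom = isCDerangementFrom injective′ (λ _ _ → z≤n) negated
    where
    injective′ : IsInjective (proj₁ (fromMatrix M))
    injective′ i i′ eq = column-unique (nonzeroColumn M i) i i′ (proj₁ (row-uniqueAt-nonzeroColumn i))
      (subst (λ j → entry M i′ j ≢ 0ℤ)
             (sym (trans (sym (lookup-nonzeroColumns i)) (trans eq (lookup-nonzeroColumns i′))))
             (proj₁ (row-uniqueAt-nonzeroColumn i′)))
    negated : ∀ i → lookup (proj₁ (fromMatrix M)) i ≡ i → lookup (proj₂ (fromMatrix M)) i ≡ true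
    negated i eq = trans (lookup∘tabulate _ i) (isNegative-unit (values i (nonzeroColumn M i))
      (proj₁ (row-uniqueAt-nonzeroColumn i))
      (diagonal i ∘ subst (λ j → entry M i j ≡ 1ℤ) (trans (sym (lookup-nonzeroColumns i)) eq)))

  toMatrix-fromMatrix : toMatrix (fromMatrix M) ≡ M
  toMatrix-fromMatrix = lookup-ext λ i → uniqueAt-ext
    (subst (UniqueAt nonzero? (lookup (toMatrix (σ , s)) i)) (lookup-nonzeroColumns i)
           (toMatrix-row-uniqueAt σ s i))
    (row-uniqueAt-nonzeroColumn i)
    (begin
      entry (toMatrix (σ , s)) i (nonzeroColumn M i)
        ≡⟨ cong (entry (toMatrix (σ , s)) i) (lookup-nonzeroColumns i) ⟨
      entry (toMatrix (σ , s)) i (lookup σ i)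
        ≡⟨ entry-toMatrix-image σ s i ⟩
      signOf (lookup s i)
        ≡⟨ cong signOf (lookup∘tabulate _ i) ⟩
      signOf (isNegative (entry M i (nonzeroColumn M i)))
        ≡⟨ signOf-isNegative (values i (nonzeroColumn M i)) (proj₁ (row-uniqueAt-nonzeroColumn i)) ⟩
      entry M i (nonzeroColumn M i) ∎)
    where
    open ≡-Reasoning
    σ = proj₁ (fromMatrix M)
    s = proj₂ (fromMatrix M)

CDerangement↔CDerangementFrom0 : ∀ n → CDerangement n ↔ CDerangementFrom n 0
CDerangement↔CDerangementFrom0 n = mk↔ₛ′ to from to∘from from∘to
  where
  to : CDerangement n → CDerangementFrom n 0
  to (M , [ ok ]) = fromMatrix M , [ fromMatrix-isCDerangementFrom ok ]
  from : CDerangementFrom n 0 → CDerangement n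
  from (σs , [ ok ]) = toMatrix σs , [ toMatrix-isCDerangement (proj₁ σs) (proj₂ σs) ok ]
  to∘from : ∀ σs → to (from σs) ≡ σs
  to∘from (σs , _) = value-injective (fromMatrix-toMatrix σs)
  from∘to : ∀ M → from (to M) ≡ M
  from∘to (M , [ ok ]) =
    value-injective (recompute (Vec.≡-dec (Vec.≡-dec ℤ._≟_) _ M) (toMatrix-fromMatrix ok))

-- Counting

cDerangementFrom-hasCard : ∀ {d : ℕ → ℕ} {N} → (∀ k → k ≤ N → HasCard (Derangement k) (d k)) →
  ∀ n m → n + m ≡ N → HasCard (CDerangementFrom N m) (binomialSum n (λ k → 2 ^ (k + m) * d (k + m)))
cDerangementFrom-hasCard {d} hd zero m refl =
  subst (HasCard (CDerangementFrom m m)) (sym (trans (+-identityʳ _) (+-identityʳ _)))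
    (↔-trans (hasCard-× (hasCard-Vec-Bool m) (hd m ≤-refl))
             (↔-sym (CDerangementFrom[n,n]↔Vec×Derangement m)))
cDerangementFrom-hasCard {d} hd (suc n) m refl =
  subst (HasCard (CDerangementFrom (suc n + m) m)) (sym pascal)
    (↔-trans (hasCard-⊎ fixing-m avoiding-m) (↔-sym (CDerangementFrom-split (m≤n+m m n))))
  where
  g : ℕ → ℕ
  g k = 2 ^ k * d k
  fixing-m : HasCard (CDerangementFrom (n + m) m) (binomialSum n (λ k → g (k + m)))
  fixing-m = cDerangementFrom-hasCard (λ k k≤ → hd k (m≤n⇒m≤1+n k≤)) n m refl
  avoiding-m : HasCard (CDerangementFrom (suc n + m) (suc m)) (binomialSum n (λ k → g (k + suc m)))
  avoiding-m = cDerangementFrom-hasCard hd n (suc m) (+-suc n m)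
  pascal : binomialSum (suc n) (λ k → g (k + m)) ≡
           binomialSum n (λ k → g (k + m)) + binomialSum n (λ k → g (k + suc m))
  pascal = trans (binomialSum-suc n (λ k → g (k + m)))
    (cong (binomialSum n (λ k → g (k + m)) +_) (binomialSum-cong n (λ k → cong g (sym (+-suc k m)))))

proposition3p2 : (n : ℕ) (dhat : ℕ) (d : ℕ → ℕ)
    → (∀ k → k ≤ n → HasCard (Derangement k) (d k))
    → HasCard (CDerangement n) dhat
    → dhat ≡ sumTo n (λ k → (n C k) * (2 ^ k) * d k)
proposition3p2 n dhat d hd hc = begin
  dhat                                              ≡⟨ hasCard-unique hc cDerangements ⟩
  binomialSum n (λ k → 2 ^ (k + 0) * d (k + 0))     ≡⟨ binomialSum-cong n (λ k → cong g (+-identityʳ k)) ⟩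
  binomialSum n g                                   ≡⟨ sumBelow-cong (suc n) (λ k → sym (*-assoc (n C k) (2 ^ k) (d k))) ⟩
  sumBelow (suc n) (λ k → (n C k) * (2 ^ k) * d k)  ≡⟨ sumTo≡sumBelow n _ ⟨
  sumTo n (λ k → (n C k) * (2 ^ k) * d k)           ∎
  where
  open ≡-Reasoning
  g : ℕ → ℕ
  g k = 2 ^ k * d k
  cDerangements : HasCard (CDerangement n) (binomialSum n (λ k → 2 ^ (k + 0) * d (k + 0)))
  cDerangements = ↔-trans (cDerangementFrom-hasCard hd n 0 (+-identityʳ n))
                          (↔-sym (CDerangement↔CDerangementFrom0 n))
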